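{- Let $\ell \geq 1$ be an integer and let $N(\ell) = \min\{n \geq 0 : L(n) = \ell\}$ be the minimum number of stones in a winning Tchoukaillon board of length $\ell$. Define integers $g_\ell = \ell$ and, for $i = \ell-1, \ell-2, \ldots, 1$, $g_i = i \left\lceil g_{i+1}/i \right\rceil$ (the least multiple of $i$ that is $\geq g_{i+1}$). Then $N(\ell) = g_1$; that is, \[ N(\ell) = \tfrac{2}{1}\left\lceil \tfrac{3}{2} \left\lceil \cdots \left\lceil \tfrac{\ell-1}{\ell-2} \left\lceil \tfrac{\ell}{\ell-1} \right\rceil \right\rceil \cdots \right\rceil \right\rceil . \]
   Context: Tchoukaillon boards. For each $n \geq 0$ define a sequence $b(n) = (b_1(n), b_2(n), \ldots)$ of nonnegative integers recursively: $b(0)$ is the all-zero sequence; given $b(n)$, let $p(n) = \min\{j \geq 1 : b_j(n) = 0\}$ and set $b_i(n+1) = b_i(n)$ if $i > p(n)$, $b_i(n+1) = i$ if $i = p(n)$, and $b_i(n+1) = b_i(n) - 1$ if $i < p(n)$. $b(n)$ is the unique winning Tchoukaillon board with $n$ stones. Its length is $L(n) = \min\{i \geq 0 : b_j(n) = 0 \text{ for all } j > i\}$. (For example $N(\ell)$ begins $1, 2, 4, 6, 10, 12, 18, \ldots$ for $\ell = 1, 2, 3, \ldots$.) -}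

module Defs where

open import Data.Nat using (ℕ; zero; suc; _+_; _*_; _∸_; _/_)
open import Data.Nat using (_<_)
open import Data.List using (List; []; _∷_)
open import Data.Product using (_×_)
open import Relation.Nullary using (¬_)
open import Relation.Binary.PropositionalEquality using (_≡_)

-- A board is the finite list (b_1, b_2, ..., b_k); all entries b_j with j > k are 0.

-- Entries before the first zero are decremented; the first zero (position p)
-- becomes p; entries after p are unchanged.  If no zero occurs in the list,
-- p is the position just after the list, which becomes p.
stepFrom : ℕ → List ℕ → List ℕ
stepFrom i []             = i ∷ []
stepFrom i (zero    ∷ bs) = i ∷ bs
stepFrom i (suc b   ∷ bs) = b ∷ stepFrom (suc i) bs

step : List ℕ → List ℕ
step = stepFrom 1

board : ℕ → List ℕ
board zero    = []
board (suc n) = step (board n)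

-- Length of a board = largest index with a nonzero entry (0 if none).
lenAux : ℕ → List ℕ → ℕ
lenAux i []             = 0
lenAux i (zero  ∷ bs) with lenAux (suc i) bs
... | zero  = 0
... | suc m = suc m
lenAux i (suc b ∷ bs) with lenAux (suc i) bs
... | zero  = i
... | suc m = suc m

boardLength : List ℕ → ℕ
boardLength = lenAux 1

L : ℕ → ℕ
L n = boardLength (board n)

-- Least multiple of (suc j) that is ≥ x, i.e. (suc j) * ⌈ x / (suc j) ⌉.
roundUp : ℕ → ℕ → ℕ
roundUp j x = suc j * ((x + j) / suc j)

-- gAux ℓ k = g_{ℓ ∸ k}  (for k < ℓ):  g_ℓ = ℓ,  g_i = i ⌈ g_{i+1} / i ⌉.
gAux : ℕ → ℕ → ℕ
gAux ℓ zero    = ℓ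
gAux ℓ (suc k) = roundUp (ℓ ∸ suc k ∸ 1) (gAux ℓ k)

g₁ : ℕ → ℕ
g₁ ℓ = gAux ℓ (ℓ ∸ 1)

IsN : ℕ → ℕ → Set
IsN ℓ m = L m ≡ ℓ × (∀ n → n < m → ¬ (L n ≡ ℓ))

module Submission where

-- Read a board (b_i, b_{i+1}, ...) as a mixed-radix numeral:
-- 'Sieve i t bs' says t = b_i + (i+1) q with 0 ≤ b_i ≤ i, where the tail
-- represents (i+1) q at level i+1.  A sowing move starting at index i adds
-- exactly i to the represented value (sieve-step), so board n represents n
-- at level 1 (sieve-board).
--
-- In this numeral system the length of a board is read off by a threshold:
-- a level-i board has length ≥ i+k iff its value is at least
-- 'threshold i k', where threshold i 0 = 1 and threshold i (k+1) is the least
-- multiple of i+1 above threshold (i+1) k (threshold-criterion).  Unfolding,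
-- threshold 1 (ℓ-1) = g₁ ℓ, so L n ≥ ℓ ⇔ n ≥ g₁ ℓ (length-criterion).
-- Since one move raises the length by at most one (L-step), the first n with
-- L n ≥ ℓ has L n = ℓ exactly (first-hit), which is the theorem.

open import Defs
open import Data.Nat using (ℕ; zero; suc; _+_; _*_; _∸_; _/_; _%_; _⊔_; _≤_; _<_; _≥_; z≤n; s≤s)
open import Data.Nat.Properties
open import Data.Nat.DivMod using (m≡m%n+[m/n]*n; m%n<n; m<n*o⇒m/o<n; n/n≡1; n/1≡n)
open import Data.Nat.Tactic.RingSolver using (solve-∀)
open import Data.List using (List; []; _∷_)
open import Data.Product using (_×_; _,_)
open import Data.Sum using (_⊎_; inj₁; inj₂)
open import Function.Bundles using (_⇔_; mk⇔; Equivalence)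
open import Function.Properties.Equivalence using (⇔-setoid)
open import Level using (0ℓ)
open import Relation.Nullary using (¬_; contradiction)
open import Relation.Binary.PropositionalEquality
  using (_≡_; refl; sym; cong; cong₂; subst; module ≡-Reasoning)

open Equivalence using (to; from)

import Relation.Binary.Reasoning.Setoid as SetoidReasoning

module ⇔-Reasoning = SetoidReasoning (⇔-setoid 0ℓ)

-- Sieve i t bs: the board tail bs = (b_i, b_{i+1}, ...) is the mixed-radix
-- expansion of t at level i, i.e. t = b_i + q (i+1) with b_i ≤ i and the rest
-- of the board expanding q (i+1) at level i+1.
data Sieve : ℕ → ℕ → List ℕ → Set where
  nil  : ∀ {i} → Sieve i 0 []
  cons : ∀ {i t b q bs} → b ≤ i → Sieve (suc i) (q * suc i) bs →
         t ≡ b + q * suc i → Sieve i t (b ∷ bs)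

-- A move from index i adds i to the represented value: every full entry
-- hands one stone on (a carry), the first empty one is refilled.
sieve-step : ∀ {i t bs} → Sieve i t bs → Sieve i (t + i) (stepFrom i bs)
sieve-step {i} nil = cons {q = 0} ≤-refl nil (sym (+-identityʳ i))
sieve-step {i} (cons {b = zero} {q} _ tail refl) =
  cons {q = q} ≤-refl tail (+-comm (q * suc i) i)
sieve-step {i} (cons {b = suc b} {q} {bs} b<i tail refl) =
  cons {q = suc q} (<⇒≤ b<i) carried (carry b (q * suc i) i)
  where
  carry : ∀ b x i → suc b + x + i ≡ b + (suc i + x)
  carry = solve-∀
  carried : Sieve (suc i) (suc q * suc i) (stepFrom (suc i) bs)
  carried = subst (λ t → Sieve (suc i) t (stepFrom (suc i) bs))
                  (+-comm (q * suc i) (suc i)) (sieve-step tail)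

sieve-board : ∀ n → Sieve 1 n (board n)
sieve-board zero    = nil
sieve-board (suc n) =
  subst (λ t → Sieve 1 t (board (suc n))) (+-comm n 1) (sieve-step (sieve-board n))

entryLength : ℕ → ℕ → ℕ
entryLength i zero    = 0
entryLength i (suc _) = i

entryLength-≤ : ∀ i b → entryLength i b ≤ i
entryLength-≤ i zero    = z≤n
entryLength-≤ i (suc _) = ≤-refl

lenAux-zero-or-≥ : ∀ i bs → lenAux i bs ≡ 0 ⊎ i ≤ lenAux i bs
lenAux-zero-or-≥ i [] = inj₁ refl
lenAux-zero-or-≥ i (zero ∷ bs) with lenAux (suc i) bs | lenAux-zero-or-≥ (suc i) bs
... | zero  | _       = inj₁ refl
... | suc _ | inj₂ i<r = inj₂ (<⇒≤ i<r)
lenAux-zero-or-≥ i (suc b ∷ bs) with lenAux (suc i) bs | lenAux-zero-or-≥ (suc i) bs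
... | zero  | _       = inj₂ ≤-refl
... | suc _ | inj₂ i<r = inj₂ (<⇒≤ i<r)

lenAux-cons : ∀ i b bs → lenAux i (b ∷ bs) ≡ entryLength i b ⊔ lenAux (suc i) bs
lenAux-cons i zero bs with lenAux (suc i) bs
... | zero  = refl
... | suc _ = refl
lenAux-cons i (suc b) bs with lenAux (suc i) bs | lenAux-zero-or-≥ (suc i) bs
... | zero  | _        = sym (⊔-identityʳ i)
... | suc r | inj₂ i<r = sym (m≤n⇒m⊔n≡n (<⇒≤ i<r))

lenAux-cons-≤ : ∀ i b bs → lenAux i (b ∷ bs) ≤ i ⊔ lenAux (suc i) bs
lenAux-cons-≤ i b bs = begin
  lenAux i (b ∷ bs)                         ≡⟨ lenAux-cons i b bs ⟩
  entryLength i b ⊔ lenAux (suc i) bs       ≤⟨ ⊔-monoˡ-≤ _ (entryLength-≤ i b) ⟩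
  i ⊔ lenAux (suc i) bs                     ∎
  where open ≤-Reasoning

stepLength : ∀ i bs → lenAux i (stepFrom i bs) ≤ i ⊔ suc (lenAux i bs)
stepLength i [] = ≤-trans (lenAux-cons-≤ i i []) (⊔-monoʳ-≤ i z≤n)
stepLength i (zero ∷ bs) = begin
  lenAux i (i ∷ bs)                         ≤⟨ lenAux-cons-≤ i i bs ⟩
  i ⊔ lenAux (suc i) bs                     ≤⟨ ⊔-monoʳ-≤ i (n≤1+n _) ⟩
  i ⊔ suc (lenAux (suc i) bs)               ≡⟨ cong (λ m → i ⊔ suc m) (lenAux-cons i zero bs) ⟨
  i ⊔ suc (lenAux i (zero ∷ bs))            ∎
  where open ≤-Reasoning
stepLength i (suc b ∷ bs) = begin
  lenAux i (b ∷ stepFrom (suc i) bs)        ≤⟨ lenAux-cons-≤ i b _ ⟩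
  i ⊔ lenAux (suc i) (stepFrom (suc i) bs)  ≤⟨ ⊔-monoʳ-≤ i (stepLength (suc i) bs) ⟩
  i ⊔ suc (i ⊔ lenAux (suc i) bs)           ≡⟨ cong (λ m → i ⊔ suc m) (lenAux-cons i (suc b) bs) ⟨
  i ⊔ suc (lenAux i (suc b ∷ bs))           ∎
  where open ≤-Reasoning

L-step : ∀ n → L (suc n) ≤ suc (L n)
L-step n = stepLength 1 (board n)

sieve-empty : ∀ {i t bs} → Sieve i t bs → t ≡ 0 ⇔ lenAux i bs ≡ 0
sieve-empty nil = mk⇔ (λ _ → refl) (λ _ → refl)
sieve-empty {i} (cons {b = zero} {bs = bs} _ tail refl) =
  subst (λ m → _ ≡ 0 ⇔ m ≡ 0) (sym (lenAux-cons i zero bs)) (sieve-empty tail)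
sieve-empty {i} (cons {b = suc b} {bs = bs} b<i _ refl) =
  mk⇔ (λ ()) (λ len≡0 → contradiction len≡0 nonempty)
  where
  open ≤-Reasoning
  nonempty : ¬ lenAux i (suc b ∷ bs) ≡ 0
  nonempty len≡0 = <⇒≱ (≤-trans (s≤s z≤n) b<i) (begin
    i                                  ≤⟨ m≤m⊔n i _ ⟩
    i ⊔ lenAux (suc i) bs              ≡⟨ lenAux-cons i (suc b) bs ⟨
    lenAux i (suc b ∷ bs)              ≡⟨ len≡0 ⟩
    0                                  ∎)

sieve-nonempty : ∀ {i t bs} → 1 ≤ i → Sieve i t bs → i ≤ lenAux i bs ⇔ 1 ≤ t
sieve-nonempty {i} {t} {bs} 1≤i s = mk⇔ reaches⇒positive positive⇒reaches
  where
  reaches⇒positive : i ≤ lenAux i bs → 1 ≤ t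
  reaches⇒positive i≤len = n≢0⇒n>0 (λ t≡0 →
    <⇒≱ 1≤i (subst (i ≤_) (to (sieve-empty s) t≡0) i≤len))
  positive⇒reaches : 1 ≤ t → i ≤ lenAux i bs
  positive⇒reaches 1≤t with lenAux-zero-or-≥ i bs
  ... | inj₁ len≡0 = contradiction (from (sieve-empty s) len≡0) (>⇒≢ 1≤t)
  ... | inj₂ i≤len = i≤len

≤-⊔-small : ∀ {ℓ e r} → e < ℓ → ℓ ≤ e ⊔ r ⇔ ℓ ≤ r
≤-⊔-small {ℓ} {e} {r} e<ℓ = mk⇔ to-tail (λ ℓ≤r → ≤-trans ℓ≤r (m≤n⊔m e r))
  where
  to-tail : ℓ ≤ e ⊔ r → ℓ ≤ r
  to-tail ℓ≤e⊔r with ⊔-sel e r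
  ... | inj₁ e⊔r≡e = contradiction (subst (ℓ ≤_) e⊔r≡e ℓ≤e⊔r) (<⇒≱ e<ℓ)
  ... | inj₂ e⊔r≡r = subst (ℓ ≤_) e⊔r≡r ℓ≤e⊔r

lenAux-cons-beyond : ∀ {ℓ} i b bs → i < ℓ → ℓ ≤ lenAux i (b ∷ bs) ⇔ ℓ ≤ lenAux (suc i) bs
lenAux-cons-beyond i b bs i<ℓ =
  subst (λ m → _ ≤ m ⇔ _) (sym (lenAux-cons i b bs))
        (≤-⊔-small (≤-<-trans (entryLength-≤ i b) i<ℓ))

roundUp-≥ : ∀ j x → x ≤ roundUp j x
roundUp-≥ j x = +-cancelʳ-≤ j x (roundUp j x) (begin
  x + j                          ≡⟨ m≡m%n+[m/n]*n (x + j) (suc j) ⟩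
  (x + j) % suc j + c * suc j    ≤⟨ +-monoˡ-≤ _ (≤-pred (m%n<n (x + j) (suc j))) ⟩
  j + c * suc j                  ≡⟨ +-comm j (c * suc j) ⟩
  c * suc j + j                  ≡⟨ cong (_+ j) (*-comm c (suc j)) ⟩
  roundUp j x + j                ∎)
  where
  c = (x + j) / suc j
  open ≤-Reasoning

roundUp-least : ∀ j x q → x ≤ q * suc j → roundUp j x ≤ q * suc j
roundUp-least j x q x≤qs = begin
  suc j * ((x + j) / suc j)      ≤⟨ *-monoʳ-≤ (suc j) (≤-pred (m<n*o⇒m/o<n x+j<[q+1]s)) ⟩
  suc j * q                      ≡⟨ *-comm (suc j) q ⟩
  q * suc j                      ∎
  where
  open ≤-Reasoning
  x+j<[q+1]s : x + j < suc q * suc j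
  x+j<[q+1]s = begin-strict
    x + j                        ≤⟨ +-monoˡ-≤ j x≤qs ⟩
    q * suc j + j                <⟨ +-monoʳ-< (q * suc j) (n<1+n j) ⟩
    q * suc j + suc j            ≡⟨ +-comm (q * suc j) (suc j) ⟩
    suc q * suc j                ∎

multiple-below : ∀ j c b q → b ≤ j → c * suc j ≤ b + q * suc j → c ≤ q
multiple-below j c b q b≤j cs≤b+qs =
  ≤-pred (*-cancelʳ-< (suc j) c (suc q) (≤-<-trans cs≤b+qs (+-monoˡ-< (q * suc j) (s≤s b≤j))))

roundUp-digit : ∀ j x b q → b ≤ j → x ≤ q * suc j ⇔ roundUp j x ≤ b + q * suc j
roundUp-digit j x b q b≤j = mk⇔
  (λ x≤qs → ≤-trans (roundUp-least j x q x≤qs) (m≤n+m (q * suc j) b))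
  (λ r≤b+qs → ≤-trans (roundUp-≥ j x) (begin
    suc j * c                    ≡⟨ *-comm (suc j) c ⟩
    c * suc j                    ≤⟨ *-monoˡ-≤ (suc j) (multiple-below j c b q b≤j
                                      (subst (_≤ b + q * suc j) (*-comm (suc j) c) r≤b+qs)) ⟩
    q * suc j                    ∎))
  where
  c = (x + j) / suc j
  open ≤-Reasoning

-- threshold i k: the least value of a level-i board of length ≥ i + k.
threshold : ℕ → ℕ → ℕ
threshold i zero    = 1
threshold i (suc k) = roundUp i (threshold (suc i) k)

threshold-positive : ∀ i k → 1 ≤ threshold i k
threshold-positive i zero    = ≤-refl
threshold-positive i (suc k) =
  ≤-trans (threshold-positive (suc i) k) (roundUp-≥ i (threshold (suc i) k))

threshold-criterion : ∀ k {i t bs} → 1 ≤ i → Sieve i t bs →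
                      i + k ≤ lenAux i bs ⇔ threshold i k ≤ t
threshold-criterion zero {i} {t} {bs} 1≤i s = begin
  i + 0 ≤ lenAux i bs            ≡⟨ cong (_≤ lenAux i bs) (+-identityʳ i) ⟩
  i ≤ lenAux i bs                ≈⟨ sieve-nonempty 1≤i s ⟩
  1 ≤ t                          ∎
  where open ⇔-Reasoning
threshold-criterion (suc k) {i} 1≤i nil = mk⇔
  (λ len≥ → contradiction (≤-trans (m≤n+m (suc k) i) len≥) λ ())
  (λ th≤0 → contradiction (≤-trans (threshold-positive i (suc k)) th≤0) λ ())
threshold-criterion (suc k) {i} {t} 1≤i (cons {b = b} {q} {bs} b≤i tail t≡) = begin
  i + suc k ≤ lenAux i (b ∷ bs)                    ≈⟨ lenAux-cons-beyond i b bs (m<m+n i (s≤s z≤n)) ⟩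
  i + suc k ≤ lenAux (suc i) bs                    ≡⟨ cong (_≤ lenAux (suc i) bs) (+-suc i k) ⟩
  suc i + k ≤ lenAux (suc i) bs                    ≈⟨ threshold-criterion k (s≤s z≤n) tail ⟩
  threshold (suc i) k ≤ q * suc i                  ≈⟨ roundUp-digit i (threshold (suc i) k) b q b≤i ⟩
  threshold i (suc k) ≤ b + q * suc i              ≡⟨ cong (threshold i (suc k) ≤_) t≡ ⟨
  threshold i (suc k) ≤ t                          ∎
  where open ⇔-Reasoning

roundUp-zero : ∀ x → roundUp 0 x ≡ x
roundUp-zero x = begin
  1 * ((x + 0) / 1)              ≡⟨ *-identityˡ _ ⟩
  (x + 0) / 1                    ≡⟨ n/1≡n (x + 0) ⟩
  x + 0                          ≡⟨ +-identityʳ x ⟩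
  x                              ∎
  where open ≡-Reasoning

gAux-index : ∀ i k → i + suc (suc k) ∸ suc k ∸ 1 ≡ i
gAux-index i k = begin
  i + suc (suc k) ∸ suc k ∸ 1    ≡⟨ ∸-+-assoc (i + suc (suc k)) (suc k) 1 ⟩
  i + suc (suc k) ∸ (suc k + 1)  ≡⟨ cong (i + suc (suc k) ∸_) (+-comm (suc k) 1) ⟩
  i + suc (suc k) ∸ suc (suc k)  ≡⟨ m+n∸n≡m i (suc (suc k)) ⟩
  i                              ∎
  where open ≡-Reasoning

-- threshold i (k+1) is g_{i+1} for ℓ = i + k + 1.
threshold≡gAux : ∀ i k → threshold i (suc k) ≡ gAux (i + suc k) k
threshold≡gAux i zero = begin
  suc i * (suc i / suc i)        ≡⟨ cong (suc i *_) (n/n≡1 (suc i)) ⟩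
  suc i * 1                      ≡⟨ *-identityʳ (suc i) ⟩
  suc i                          ≡⟨ +-comm 1 i ⟩
  i + 1                          ∎
  where open ≡-Reasoning
threshold≡gAux i (suc k) = begin
  roundUp i (threshold (suc i) (suc k))
    ≡⟨ cong (roundUp i) (threshold≡gAux (suc i) k) ⟩
  roundUp i (gAux (suc i + suc k) k)
    ≡⟨ cong₂ roundUp (gAux-index i k) (cong (λ ℓ → gAux ℓ k) (+-suc i (suc k))) ⟨
  roundUp (i + suc (suc k) ∸ suc k ∸ 1) (gAux (i + suc (suc k)) k)
    ∎
  where open ≡-Reasoning

-- g₁ ℓ is the level-1 threshold for length ℓ (using g₁ = g₂).
g₁≡threshold : ∀ l → g₁ (suc l) ≡ threshold 1 l
g₁≡threshold zero    = refl
g₁≡threshold (suc m) = begin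
  roundUp (suc (suc m) ∸ suc m ∸ 1) (gAux (suc (suc m)) m)
    ≡⟨ cong (λ j → roundUp j (gAux (suc (suc m)) m)) (gAux-index 0 m) ⟩
  roundUp 0 (gAux (suc (suc m)) m)
    ≡⟨ roundUp-zero (gAux (suc (suc m)) m) ⟩
  gAux (suc (suc m)) m
    ≡⟨ threshold≡gAux 1 m ⟨
  threshold 1 (suc m)
    ∎
  where open ≡-Reasoning

length-criterion : ∀ l n → suc l ≤ L n ⇔ g₁ (suc l) ≤ n
length-criterion l n =
  subst (λ G → suc l ≤ L n ⇔ G ≤ n) (sym (g₁≡threshold l))
        (threshold-criterion l ≤-refl (sieve-board n))

first-hit : (f : ℕ → ℕ) → f 0 ≡ 0 → (∀ n → f (suc n) ≤ suc (f n)) →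
            ∀ ℓ G → (∀ n → ℓ ≤ f n ⇔ G ≤ n) →
            f G ≡ ℓ × (∀ n → n < G → ¬ f n ≡ ℓ)
first-hit f f0≡0 slow ℓ G criterion =
  ≤-antisym (at-most G ≤-refl) (from (criterion G) ≤-refl) , never
  where
  below : ∀ n → n < G → f n < ℓ
  below n n<G = ≰⇒> (λ ℓ≤fn → <⇒≱ n<G (to (criterion n) ℓ≤fn))
  at-most : ∀ n → n ≤ G → f n ≤ ℓ
  at-most zero    _   = subst (_≤ ℓ) (sym f0≡0) z≤n
  at-most (suc n) n<G = ≤-trans (slow n) (below n n<G)
  never : ∀ n → n < G → ¬ f n ≡ ℓ
  never n n<G fn≡ℓ = <⇒≢ (below n n<G) fn≡ℓ

theorem3p5 : (ℓ : ℕ) → ℓ ≥ 1 → IsN ℓ (g₁ ℓ)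
theorem3p5 zero    ()
theorem3p5 (suc l) _ = first-hit L refl L-step (suc l) (g₁ (suc l)) (length-criterion l)
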